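{- For all positive integers $m,n$ with $mn$ even, the graph $\mathcal{D}_3(\mathbb{T}_{m,n})$ is connected and has diameter at most $2mn$.
   Context: The triangular lattice $\mathbb{T}$ is the graph with vertex set $\mathbb{Z}^2$ in which each vertex $\mathbf{v}$ is adjacent to $\mathbf{v}+(1,0),\mathbf{v}+(-1,0),\mathbf{v}+(0,1),\mathbf{v}+(0,-1),\mathbf{v}+(1,-1),\mathbf{v}+(-1,1)$. $\mathbb{T}_{m,n}$ is the subgraph of $\mathbb{T}$ induced by $\{1,\dots,m\}\times\{1,\dots,n\}$. A dimer configuration on a graph $G$ is a perfect matching; its edges are dimers. An alternating cycle is a cycle of even length in which every second edge is a dimer; switching it exchanges dimer and non-dimer edges along the cycle. For $\ell\ge 2$, $\mathcal{D}_\ell(G)$ is the graph on dimer configurations of $G$ in which two configurations are adjacent if one is obtained from the other by switching an alternating cycle of length at most $2\ell$ (so $\mathcal{D}_3$ uses cycles of length $4$ and $6$). -}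

module Defs where

open import Data.Nat using (ℕ; zero; suc; _+_; _*_; _≤_)
open import Data.Nat.DivMod using (_%_; m%n<n)
open import Data.Fin using (Fin; toℕ; fromℕ<)
open import Data.Product using (_×_; _,_; Σ; ∃; ∃-syntax; proj₁; proj₂)
open import Data.Sum using (_⊎_; inj₁; inj₂; [_,_]′)
open import Relation.Binary.PropositionalEquality using (_≡_; _≢_)
open import Function.Definitions using (Injective)

-- Vertices of T_{m,n}: the point (i , j) : Fin m × Fin n stands for
-- (toℕ i + 1 , toℕ j + 1) ∈ {1..m} × {1..n}.
Vertex : ℕ → ℕ → Set
Vertex m n = Fin m × Fin n

-- Adjacency in the triangular lattice T (induced subgraph on the box):
-- w = v + d with d ∈ {(1,0),(-1,0),(0,1),(0,-1),(1,-1),(-1,1)}.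
Adj : ∀ {m n} → Vertex m n → Vertex m n → Set
Adj (i , j) (i' , j') =
    (toℕ i' ≡ suc (toℕ i) × toℕ j' ≡ toℕ j)
  ⊎ (toℕ i ≡ suc (toℕ i') × toℕ j' ≡ toℕ j)
  ⊎ (toℕ i' ≡ toℕ i × toℕ j' ≡ suc (toℕ j))
  ⊎ (toℕ i' ≡ toℕ i × toℕ j ≡ suc (toℕ j'))
  ⊎ (toℕ i' ≡ suc (toℕ i) × toℕ j ≡ suc (toℕ j'))
  ⊎ (toℕ i ≡ suc (toℕ i') × toℕ j' ≡ suc (toℕ j))

-- A dimer configuration (perfect matching) of T_{m,n}, represented by the
-- partner map: every vertex is matched to exactly one adjacent vertex.
record Dimer (m n : ℕ) : Set where
  field
    partner    : Vertex m n → Vertex m n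
    involutive : ∀ v → partner (partner v) ≡ v
    noFix      : ∀ v → partner v ≢ v
    adjacent   : ∀ v → Adj v (partner v)
open Dimer public

_≈D_ : ∀ {m n} → Dimer m n → Dimer m n → Set
M ≈D M' = ∀ v → partner M v ≡ partner M' v

next : ∀ {k} → Fin (suc k) → Fin (suc k)
next {k} i = fromℕ< (m%n<n (suc (toℕ i)) (suc k))

-- A cycle of length 2k (k ≥ 2) in T_{m,n}:
--   a 0 , b 0 , a 1 , b 1 , … , a (k-1) , b (k-1) , (back to a 0)
-- with all 2k vertices distinct and consecutive vertices adjacent.
record Cycle (m n k : ℕ) : Set where
  field
    a b      : Fin (suc (suc k)) → Vertex m n
    distinct : Injective _≡_ _≡_ (λ (x : Fin (suc (suc k)) ⊎ Fin (suc (suc k))) →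
                 [ a , b ]′ x)
    adjAB    : ∀ i → Adj (a i) (b i)
    adjBA    : ∀ i → Adj (b i) (a (next i))
open Cycle public

vert : ∀ {m n k} → Cycle m n k → Fin (suc (suc k)) ⊎ Fin (suc (suc k)) → Vertex m n
vert C = [ a C , b C ]′

-- M' is obtained from M by switching the alternating cycle C:
-- in M the dimers are a i — b i (every second edge), in M' they are
-- b i — a (next i), and off the cycle M and M' agree.
Switch : ∀ {m n k} → Dimer m n → Cycle m n k → Dimer m n → Set
Switch {m} {n} M C M' =
    (∀ i → partner M (a C i) ≡ b C i)
  × (∀ i → partner M' (b C i) ≡ a C (next i))
  × (∀ (v : Vertex m n) → (∀ x → vert C x ≢ v) → partner M' v ≡ partner M v)

-- adjacency in D_ℓ(T_{m,n}): switch an alternating cycle of length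
-- 2 * (suc (suc k)) ≤ 2ℓ.
Step : ∀ {m n} → ℕ → Dimer m n → Dimer m n → Set
Step {m} {n} ℓ M M' =
  ∃[ k ] (2 * suc (suc k) ≤ 2 * ℓ × Σ (Cycle m n k) λ C → Switch M C M')

-- M' is reachable from M by a path of length at most t in D_ℓ(T_{m,n})
-- (configurations identified up to ≈D, i.e. having the same dimers).
ReachWithin : ∀ {m n} → ℕ → ℕ → Dimer m n → Dimer m n → Set
ReachWithin ℓ zero    M M' = M ≈D M'
ReachWithin ℓ (suc t) M M' = M ≈D M' ⊎ ∃[ M'' ] (Step ℓ M M'' × ReachWithin ℓ t M'' M')

-- D_ℓ(T_{m,n}) is connected (nonempty, every two vertices joined by a path)
-- and has diameter at most d.
ConnectedDiamAtMost : ℕ → ℕ → ℕ → ℕ → Set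
ConnectedDiamAtMost ℓ m n d =
  Dimer m n × (∀ (M M' : Dimer m n) → ReachWithin ℓ d M M')

{-# OPTIONS --safe #-}
module Submission where

-- Let n be even and M₀ the configuration of vertical dimers {(x , 2s) , (x , 2s + 1)}.  Sweep the
-- grid in lexicographic order: if M agrees with M₀ on every vertex before (i , 2t), then for some
-- k ≥ 1 at most 2k switches of alternating 4- and 6-cycles through unswept vertices make M agree
-- with M₀ on every vertex before (i , 2t + 2k).  So every configuration is joined to M₀ by a path
-- of length at most mn, and, switches being reversible, any two configurations by one of length at
-- most 2mn; even m is reduced to even n by transposing the grid.  The local step is a finite case
-- analysis of the dimers near (i , 2t), recorded as a certificate whose validity is decided by
-- evaluation and whose soundness is proved uniformly in i, t, m and n.

open import Defs
open import Algebra.Bundles using (AbelianGroup)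
open import Data.Empty using (⊥; ⊥-elim)
open import Data.Fin using (Fin; toℕ; fromℕ; fromℕ<; inject₁)
import Data.Fin as Fin
import Data.Fin.Properties as Fin
open import Data.Integer using (ℤ; +_; -[1+_]; _⊖_; sign; 0ℤ; 1ℤ; pred; -_) renaming (suc to sucℤ)
import Data.Integer.Properties as ℤ
open import Data.List using (List; []; _∷_; _++_; map; tabulate; filter)
open import Data.List.Relation.Unary.All as All using (All; []; _∷_)
open import Data.List.Relation.Unary.All.Properties using (++⁺; tabulate⁺; map⁺; filter⁺; all-filter)
open import Data.List.Relation.Unary.Any as Any using (Any)
open import Data.Nat using (ℕ; zero; suc; _+_; _*_; _≤_; _<_; z≤n; s≤s; _≤?_; _<?_)
open import Data.Nat.Divisibility using (_∣_; divides)
open import Data.Nat.DivMod using (_%_; m<n⇒m%n≡m; n%n≡0)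
open import Data.Nat.Induction using (<-rec)
open import Data.Nat.Primality using (prime?; euclidsLemma)
open import Data.Nat.Properties
open import Data.Product using (∃; ∃₂; _×_; _,_; proj₁; proj₂)
open import Data.Product.Properties using (≡-dec; ,-injective)
import Data.Sign as Sign
open import Data.Sum using (_⊎_; inj₁; inj₂; [_,_]′)
open import Data.Sum.Properties using (inj₁-injective)
open import Data.Unit using (tt)
open import Data.Vec using (Vec; lookup; []; _∷_)
open import Function using (_∘_; id; _⇔_; mk⇔; Equivalence)
open import Relation.Binary using (DecidableEquality)
open import Relation.Binary.PropositionalEquality
open import Relation.Nullary using (¬_; Dec; yes; no; map′; ¬?; _×-dec_; _⊎-dec_; _→-dec_)
open import Relation.Nullary.Decidable using (toWitness; from-yes)
open import Relation.Unary using (Decidable)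

open import Algebra.Properties.Group (AbelianGroup.group ℤ.+-0-abelianGroup) using (∙-cancelʳ)

Adj-sym : ∀ {m n} {u v : Vertex m n} → Adj u v → Adj v u
Adj-sym (inj₁ (p , q))                               = inj₂ (inj₁ (p , sym q))
Adj-sym (inj₂ (inj₁ (p , q)))                        = inj₁ (p , sym q)
Adj-sym (inj₂ (inj₂ (inj₁ (p , q))))                 = inj₂ (inj₂ (inj₂ (inj₁ (sym p , q))))
Adj-sym (inj₂ (inj₂ (inj₂ (inj₁ (p , q)))))          = inj₂ (inj₂ (inj₁ (sym p , q)))
Adj-sym (inj₂ (inj₂ (inj₂ (inj₂ (inj₁ (p , q))))))   = inj₂ (inj₂ (inj₂ (inj₂ (inj₂ (p , q)))))
Adj-sym (inj₂ (inj₂ (inj₂ (inj₂ (inj₂ (p , q))))))   = inj₂ (inj₂ (inj₂ (inj₂ (inj₁ (p , q)))))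

_≟ᵥ_ : ∀ {m n} (u v : Vertex m n) → Dec (u ≡ v)
_≟ᵥ_ = ≡-dec Fin._≟_ Fin._≟_

next-suc-or-wrap : ∀ {k} (x : Fin (suc k)) →
  toℕ (next x) ≡ suc (toℕ x) ⊎ (toℕ x ≡ k × toℕ (next x) ≡ 0)
next-suc-or-wrap {k} x with m≤n⇒m<n∨m≡n (Fin.toℕ<n x)
... | inj₁ lt = inj₁ (trans (Fin.toℕ-fromℕ< _) (m<n⇒m%n≡m lt))
... | inj₂ eq = inj₂ (suc-injective eq , trans (Fin.toℕ-fromℕ< _) (trans (cong (_% suc k) eq) (n%n≡0 (suc k))))

next-injective : ∀ {k} {x y : Fin (suc k)} → next x ≡ next y → x ≡ y
next-injective {x = x} {y} e with next-suc-or-wrap x | next-suc-or-wrap y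
... | inj₁ p       | inj₁ q       = Fin.toℕ-injective (suc-injective (trans (sym p) (trans (cong toℕ e) q)))
... | inj₁ p       | inj₂ (_ , q) = ⊥-elim (1+n≢0 (trans (sym p) (trans (cong toℕ e) q)))
... | inj₂ (_ , p) | inj₁ q       = ⊥-elim (1+n≢0 (trans (sym q) (trans (cong toℕ (sym e)) p)))
... | inj₂ (p , _) | inj₂ (q , _) = Fin.toℕ-injective (trans p (sym q))

next-surjective : ∀ {k} (y : Fin (suc k)) → ∃ λ x → next x ≡ y
next-surjective {k} Fin.zero with next-suc-or-wrap (fromℕ k)
... | inj₁ p =
  ⊥-elim (<-irrefl refl (subst (_< suc k) (trans p (cong suc (Fin.toℕ-fromℕ k))) (Fin.toℕ<n (next (fromℕ k)))))
... | inj₂ (_ , p) = fromℕ k , Fin.toℕ-injective p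
next-surjective {suc k} (Fin.suc y) with next-suc-or-wrap (inject₁ y)
... | inj₁ p = inject₁ y , Fin.toℕ-injective (trans p (cong suc (Fin.toℕ-inject₁ y)))
... | inj₂ (p , _) = ⊥-elim (Fin.toℕ-inject₁-≢ y (sym p))

-- Switching alternating cycles

module Switching {m n k : ℕ} (M : Dimer m n) (C : Cycle m n k)
                 (alternating : ∀ i → partner M (a C i) ≡ b C i) where

  private
    a-injective : ∀ {x y} → a C x ≡ a C y → x ≡ y
    a-injective e with distinct C {inj₁ _} {inj₁ _} e
    ... | refl = refl

    b-injective : ∀ {x y} → b C x ≡ b C y → x ≡ y
    b-injective e with distinct C {inj₂ _} {inj₂ _} e
    ... | refl = refl

    a≢b : ∀ {x y} → a C x ≢ b C y
    a≢b e with distinct C {inj₁ _} {inj₂ _} e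
    ... | ()

    partner-b : ∀ i → partner M (b C i) ≡ a C i
    partner-b i = trans (cong (partner M) (sym (alternating i))) (involutive M (a C i))

    IsB IsNextA : Vertex m n → Set
    IsB v     = ∃ λ i → b C i ≡ v
    IsNextA v = ∃ λ i → a C (next i) ≡ v

    isB? : ∀ v → Dec (IsB v)
    isB? v = Fin.any? (λ i → b C i ≟ᵥ v)

    isNextA? : ∀ v → Dec (IsNextA v)
    isNextA? v = Fin.any? (λ i → a C (next i) ≟ᵥ v)

    off-cycle : ∀ {v} → ¬ IsB v → ¬ IsNextA v → ∀ x → vert C x ≢ v
    off-cycle _   ¬a (inj₁ i) e with next-surjective i
    ... | i₀ , refl = ¬a (i₀ , e)
    off-cycle ¬b _  (inj₂ i) e = ¬b (i , e)

    select : ∀ v → Dec (IsB v) → Dec (IsNextA v) → Vertex m n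
    select v (yes (i , _)) _             = a C (next i)
    select v (no _)        (yes (i , _)) = b C i
    select v (no _)        (no _)        = partner M v

    partner′ : Vertex m n → Vertex m n
    partner′ v = select v (isB? v) (isNextA? v)

    partner′-b : ∀ {v} i → b C i ≡ v → partner′ v ≡ a C (next i)
    partner′-b {v} i e with isB? v
    ... | yes (_ , e′) = cong (a C ∘ next) (b-injective (trans e′ (sym e)))
    ... | no ¬b = ⊥-elim (¬b (i , e))

    partner′-a : ∀ {v} i → a C (next i) ≡ v → partner′ v ≡ b C i
    partner′-a {v} i e with isB? v
    ... | yes (_ , e′) = ⊥-elim (a≢b (trans e (sym e′)))
    ... | no _ with isNextA? v
    ...   | yes (_ , e′) = cong (b C) (next-injective (a-injective (trans e′ (sym e))))
    ...   | no ¬a = ⊥-elim (¬a (i , e))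

    partner′-off : ∀ {v} → (∀ x → vert C x ≢ v) → partner′ v ≡ partner M v
    partner′-off {v} off with isB? v
    ... | yes (i , e) = ⊥-elim (off (inj₂ i) e)
    ... | no _ with isNextA? v
    ...   | yes (i , e) = ⊥-elim (off (inj₁ (next i)) e)
    ...   | no _ = refl

    partner-off : ∀ {v} → ¬ IsB v → ¬ IsNextA v → ∀ x → vert C x ≢ partner M v
    partner-off {v} ¬b _ (inj₁ i) e =
      ¬b (i , trans (sym (alternating i)) (trans (cong (partner M) e) (involutive M v)))
    partner-off {v} _ ¬a (inj₂ i) e with next-surjective i
    ... | i₀ , refl = ¬a (i₀ , trans (sym (partner-b (next i₀))) (trans (cong (partner M) e) (involutive M v)))

    involutive′ : ∀ v → partner′ (partner′ v) ≡ v
    involutive′ v = cases (isB? v) (isNextA? v)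
      where
      cases : Dec (IsB v) → Dec (IsNextA v) → partner′ (partner′ v) ≡ v
      cases (yes (i , e)) _ = trans (cong partner′ (partner′-b i e)) (trans (partner′-a i refl) e)
      cases (no _) (yes (i , e)) = trans (cong partner′ (partner′-a i e)) (trans (partner′-b i refl) e)
      cases (no ¬b) (no ¬a) =
        trans (cong partner′ (partner′-off (off-cycle ¬b ¬a)))
              (trans (partner′-off (partner-off ¬b ¬a)) (involutive M v))

    noFix′ : ∀ v → partner′ v ≢ v
    noFix′ v = cases (isB? v) (isNextA? v)
      where
      cases : Dec (IsB v) → Dec (IsNextA v) → partner′ v ≢ v
      cases (yes (i , e)) _ q = a≢b (trans (trans (sym (partner′-b i e)) q) (sym e))
      cases (no _) (yes (i , e)) q = a≢b (trans e (trans (sym q) (partner′-a i e)))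
      cases (no ¬b) (no ¬a) q = noFix M v (trans (sym (partner′-off (off-cycle ¬b ¬a))) q)

    adjacent′ : ∀ v → Adj v (partner′ v)
    adjacent′ v = cases (isB? v) (isNextA? v)
      where
      cases : Dec (IsB v) → Dec (IsNextA v) → Adj v (partner′ v)
      cases (yes (i , e)) _ = subst₂ Adj e (sym (partner′-b i e)) (adjBA C i)
      cases (no _) (yes (i , e)) = subst₂ Adj e (sym (partner′-a i e)) (Adj-sym (adjBA C i))
      cases (no ¬b) (no ¬a) = subst (Adj v) (sym (partner′-off (off-cycle ¬b ¬a))) (adjacent M v)

  switched : Dimer m n
  switched = record { partner = partner′ ; involutive = involutive′ ; noFix = noFix′ ; adjacent = adjacent′ }

  switched-Switch : Switch M C switched
  switched-Switch = alternating , (λ i → partner′-b i refl) , (λ v off → partner′-off off)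

reverseᶜ : ∀ {m n k} → Cycle m n k → Cycle m n k
reverseᶜ C = record
  { a = b C ; b = a C ∘ next ; distinct = distinct′
  ; adjAB = adjBA C ; adjBA = adjAB C ∘ next }
  where
  distinct′ : ∀ {x y} → [ b C , a C ∘ next ]′ x ≡ [ b C , a C ∘ next ]′ y → x ≡ y
  distinct′ {inj₁ x} {inj₁ y} e with distinct C {inj₂ x} {inj₂ y} e
  ... | refl = refl
  distinct′ {inj₁ x} {inj₂ y} e with distinct C {inj₂ x} {inj₁ (next y)} e
  ... | ()
  distinct′ {inj₂ x} {inj₁ y} e with distinct C {inj₁ (next x)} {inj₂ y} e
  ... | ()
  distinct′ {inj₂ x} {inj₂ y} e =
    cong inj₂ (next-injective (inj₁-injective (distinct C {inj₁ (next x)} {inj₁ (next y)} e)))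

-- Walks in D_ℓ

-- Walks rather than ReachWithin, so that the endpoints are indices of an inductive family and can
-- be inferred.
infixr 5 _∷_

data Walk {m n : ℕ} (ℓ : ℕ) : ℕ → Dimer m n → Dimer m n → Set where
  [_] : ∀ {t M M′} → M ≈D M′ → Walk ℓ t M M′
  _∷_ : ∀ {t M M′ M″} → Step ℓ M M′ → Walk ℓ t M′ M″ → Walk ℓ (suc t) M M″

module _ {m n ℓ : ℕ} where

  Step-sym : {M M′ : Dimer m n} → Step ℓ M M′ → Step ℓ M′ M
  Step-sym {M} {M′} (k , len , C , alt , alt′ , off) = k , len , reverseᶜ C , alt′ , alt ∘ next , off′
    where
    off′ : ∀ v → (∀ x → vert (reverseᶜ C) x ≢ v) → partner M v ≡ partner M′ v
    off′ v notOn = sym (off v notOnC)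
      where
      notOnC : ∀ x → vert C x ≢ v
      notOnC (inj₁ i) e with next-surjective i
      ... | i₀ , refl = notOn (inj₂ i₀) e
      notOnC (inj₂ i) e = notOn (inj₁ i) e

  Step-respˡ : {M₁ M₂ M₃ : Dimer m n} → M₁ ≈D M₂ → Step ℓ M₂ M₃ → Step ℓ M₁ M₃
  Step-respˡ e (k , len , C , alt , alt′ , off) =
    k , len , C , (λ i → trans (e (a C i)) (alt i)) , alt′ , (λ v notOn → trans (off v notOn) (sym (e v)))

  Walk-respˡ : ∀ {t} {M₁ M₂ M₃ : Dimer m n} → M₁ ≈D M₂ → Walk ℓ t M₂ M₃ → Walk ℓ t M₁ M₃
  Walk-respˡ e [ e′ ] = [ (λ v → trans (e v) (e′ v)) ]
  Walk-respˡ {M₁ = M₁} {M₂} e (_∷_ {M′ = M′} st w) = Step-respˡ {M₁ = M₁} {M₂} {M′} e st ∷ w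

  Walk-respʳ : ∀ {t} {M₁ M₂ M₃ : Dimer m n} → Walk ℓ t M₁ M₂ → M₂ ≈D M₃ → Walk ℓ t M₁ M₃
  Walk-respʳ [ e′ ]   e = [ (λ v → trans (e′ v) (e v)) ]
  Walk-respʳ (st ∷ w) e = st ∷ Walk-respʳ w e

  Walk-mono : ∀ {t s} {M M′ : Dimer m n} → t ≤ s → Walk ℓ t M M′ → Walk ℓ s M M′
  Walk-mono _         [ e ]    = [ e ]
  Walk-mono (s≤s t≤s) (st ∷ w) = st ∷ Walk-mono t≤s w

  Walk-trans : ∀ {t s} {M₁ M₂ M₃ : Dimer m n} → Walk ℓ t M₁ M₂ → Walk ℓ s M₂ M₃ → Walk ℓ (t + s) M₁ M₃
  Walk-trans {t} {s} [ e ] w′ = Walk-mono (m≤n+m s t) (Walk-respˡ e w′)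
  Walk-trans (st ∷ w) w′ = st ∷ Walk-trans w w′

  Walk-sym : ∀ {t} {M M′ : Dimer m n} → Walk ℓ t M M′ → Walk ℓ t M′ M
  Walk-sym [ e ] = [ (λ v → sym (e v)) ]
  Walk-sym {suc t} {M} {M″} (_∷_ {M′ = M′} st w) =
    subst (λ s → Walk ℓ s M″ M) (+-comm t 1)
      (Walk-trans (Walk-sym w) (_∷_ {M′ = M} (Step-sym {M} {M′} st) [ (λ v → refl) ]))

  Walk⇒ReachWithin : ∀ {t} {M M′ : Dimer m n} → Walk ℓ t M M′ → ReachWithin ℓ t M M′
  Walk⇒ReachWithin {zero}  [ e ]    = e
  Walk⇒ReachWithin {suc t} [ e ]    = inj₁ e
  Walk⇒ReachWithin         (st ∷ w) = inj₂ (_ , st , Walk⇒ReachWithin w)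

  diameter-via-hub : ∀ d (M₀ : Dimer m n) → (∀ M → Walk ℓ d M M₀) → ConnectedDiamAtMost ℓ m n (2 * d)
  diameter-via-hub d M₀ walk = M₀ , λ M M′ →
    subst (λ s → ReachWithin ℓ s M M′) (cong (_+_ d) (sym (+-identityʳ d)))
      (Walk⇒ReachWithin (Walk-trans (walk M) (Walk-sym (walk M′))))

transposeᵥ : ∀ {m n} → Vertex m n → Vertex n m
transposeᵥ (x , y) = y , x

Adj-transpose : ∀ {m n} {u v : Vertex m n} → Adj u v → Adj (transposeᵥ u) (transposeᵥ v)
Adj-transpose (inj₁ (p , q))                             = inj₂ (inj₂ (inj₁ (q , p)))
Adj-transpose (inj₂ (inj₁ (p , q)))                      = inj₂ (inj₂ (inj₂ (inj₁ (q , p))))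
Adj-transpose (inj₂ (inj₂ (inj₁ (p , q))))               = inj₁ (q , p)
Adj-transpose (inj₂ (inj₂ (inj₂ (inj₁ (p , q)))))        = inj₂ (inj₁ (q , p))
Adj-transpose (inj₂ (inj₂ (inj₂ (inj₂ (inj₁ (p , q)))))) = inj₂ (inj₂ (inj₂ (inj₂ (inj₂ (q , p)))))
Adj-transpose (inj₂ (inj₂ (inj₂ (inj₂ (inj₂ (p , q)))))) = inj₂ (inj₂ (inj₂ (inj₂ (inj₁ (q , p)))))

module _ {m n : ℕ} where

  transposeᴰ : Dimer m n → Dimer n m
  transposeᴰ M = record
    { partner    = transposeᵥ ∘ partner M ∘ transposeᵥ
    ; involutive = λ v → cong transposeᵥ (involutive M (transposeᵥ v))
    ; noFix      = λ v e → noFix M (transposeᵥ v) (cong transposeᵥ e)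
    ; adjacent   = λ v → Adj-transpose (adjacent M (transposeᵥ v)) }

  transposeᶜ : ∀ {k} → Cycle m n k → Cycle n m k
  transposeᶜ C = record
    { a = transposeᵥ ∘ a C ; b = transposeᵥ ∘ b C
    ; distinct = λ {x} {y} e → distinct C (cong transposeᵥ (trans (sym (vert-transpose x)) (trans e (vert-transpose y))))
    ; adjAB = Adj-transpose ∘ adjAB C ; adjBA = Adj-transpose ∘ adjBA C }
    where
    vert-transpose : ∀ x → [ transposeᵥ ∘ a C , transposeᵥ ∘ b C ]′ x ≡ transposeᵥ (vert C x)
    vert-transpose (inj₁ _) = refl
    vert-transpose (inj₂ _) = refl

  Step-transpose : ∀ {ℓ} {M M′ : Dimer m n} → Step ℓ M M′ → Step ℓ (transposeᴰ M) (transposeᴰ M′)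
  Step-transpose (k , len , C , alt , alt′ , off) =
    k , len , transposeᶜ C , cong transposeᵥ ∘ alt , cong transposeᵥ ∘ alt′ ,
    λ v notOn → cong transposeᵥ (off (transposeᵥ v) (λ x e → notOn x (vert-transpose x e)))
    where
    vert-transpose : ∀ {v} x → vert C x ≡ transposeᵥ v → vert (transposeᶜ C) x ≡ v
    vert-transpose (inj₁ _) e = cong transposeᵥ e
    vert-transpose (inj₂ _) e = cong transposeᵥ e

  Walk-transpose : ∀ {ℓ t} {M M′ : Dimer m n} → Walk ℓ t M M′ → Walk ℓ t (transposeᴰ M) (transposeᴰ M′)
  Walk-transpose [ e ] = [ (λ v → cong transposeᵥ (e (transposeᵥ v))) ]
  Walk-transpose {ℓ} {M = M} (_∷_ {M′ = M′} st w) = Step-transpose {ℓ} {M} {M′} st ∷ Walk-transpose w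

walks-to-transpose : ∀ {m n ℓ d} {M₀ : Dimer n m} →
  (∀ M → Walk ℓ d M M₀) → ∀ (M : Dimer m n) → Walk ℓ d M (transposeᴰ M₀)
walks-to-transpose walk M =
  Walk-respˡ {M₁ = M} {transposeᴰ (transposeᴰ M)} (λ v → refl) (Walk-transpose (walk (transposeᴰ M)))

-- The reference configuration and the sweep

double : ℕ → ℕ
double zero    = zero
double (suc c) = suc (suc (double c))

double-+ : ∀ a b → double (a + b) ≡ double a + double b
double-+ zero    b = refl
double-+ (suc a) b = cong (suc ∘ suc) (double-+ a b)

double-cancel-≤ : ∀ {a b} → double a ≤ double b → a ≤ b
double-cancel-≤ {zero}              _               = z≤n
double-cancel-≤ {suc a} {suc b} (s≤s (s≤s le)) = s≤s (double-cancel-≤ le)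

double-<-suc : ∀ {a b} → a < b → suc (double a) < double b
double-<-suc {zero}  {suc b} _         = s≤s (s≤s z≤n)
double-<-suc {suc a} {suc b} (s≤s lt) = s≤s (s≤s (double-<-suc lt))

mate : ℕ → ℕ
mate zero          = 1
mate (suc zero)    = 0
mate (suc (suc r)) = suc (suc (mate r))

mate-involutive : ∀ r → mate (mate r) ≡ r
mate-involutive zero          = refl
mate-involutive (suc zero)    = refl
mate-involutive (suc (suc r)) = cong (suc ∘ suc) (mate-involutive r)

mate-≢ : ∀ r → mate r ≢ r
mate-≢ (suc (suc r)) e = mate-≢ r (suc-injective (suc-injective e))

mate-adjacent : ∀ r → mate r ≡ suc r ⊎ r ≡ suc (mate r)
mate-adjacent zero          = inj₁ refl
mate-adjacent (suc zero)    = inj₂ refl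
mate-adjacent (suc (suc r)) with mate-adjacent r
... | inj₁ e = inj₁ (cong (suc ∘ suc) e)
... | inj₂ e = inj₂ (cong (suc ∘ suc) e)

mate-< : ∀ r c → r < double c → mate r < double c
mate-< zero          (suc c) _                 = s≤s (s≤s z≤n)
mate-< (suc zero)    (suc c) _                 = s≤s z≤n
mate-< (suc (suc r)) (suc c) (s≤s (s≤s lt)) = s≤s (s≤s (mate-< r c lt))

mate-double-+ : ∀ t r → mate (double t + r) ≡ double t + mate r
mate-double-+ zero    r = refl
mate-double-+ (suc t) r = cong (suc ∘ suc) (mate-double-+ t r)

mate-even : ∀ s → mate (double s) ≡ suc (double s)
mate-even zero    = refl
mate-even (suc s) = cong (suc ∘ suc) (mate-even s)

mate-odd : ∀ s → mate (suc (double s)) ≡ double s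
mate-odd zero    = refl
mate-odd (suc s) = cong (suc ∘ suc) (mate-odd s)

halve : ∀ r k → r < double k → ∃ λ s → s < k × (r ≡ double s ⊎ r ≡ suc (double s))
halve zero          (suc k) _ = 0 , s≤s z≤n , inj₁ refl
halve (suc zero)    (suc k) _ = 0 , s≤s z≤n , inj₂ refl
halve (suc (suc r)) (suc k) (s≤s (s≤s lt)) with halve r k lt
... | s , s<k , inj₁ e = suc s , s≤s s<k , inj₁ (cong (suc ∘ suc) e)
... | s , s<k , inj₂ e = suc s , s≤s s<k , inj₂ (cong (suc ∘ suc) e)

module Reference {m n h : ℕ} (n≡ : n ≡ double h) where

  mateFin : Fin n → Fin n
  mateFin y = fromℕ< (subst (mate (toℕ y) <_) (sym n≡) (mate-< (toℕ y) h (subst (toℕ y <_) n≡ (Fin.toℕ<n y))))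

  toℕ-mateFin : ∀ y → toℕ (mateFin y) ≡ mate (toℕ y)
  toℕ-mateFin y = Fin.toℕ-fromℕ< _

  partner₀ : Vertex m n → Vertex m n
  partner₀ (x , y) = x , mateFin y

  M₀ : Dimer m n
  M₀ = record { partner = partner₀ ; involutive = involutive₀ ; noFix = noFix₀ ; adjacent = adjacent₀ }
    where
    involutive₀ : ∀ v → partner₀ (partner₀ v) ≡ v
    involutive₀ (x , y) = cong (x ,_) (Fin.toℕ-injective
      (trans (toℕ-mateFin (mateFin y)) (trans (cong mate (toℕ-mateFin y)) (mate-involutive (toℕ y)))))

    noFix₀ : ∀ v → partner₀ v ≢ v
    noFix₀ (x , y) e = mate-≢ (toℕ y) (trans (sym (toℕ-mateFin y)) (cong (toℕ ∘ proj₂) e))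

    adjacent₀ : ∀ v → Adj v (partner₀ v)
    adjacent₀ (x , y) with mate-adjacent (toℕ y)
    ... | inj₁ e = inj₂ (inj₂ (inj₁ (refl , trans (toℕ-mateFin y) e)))
    ... | inj₂ e = inj₂ (inj₂ (inj₂ (inj₁ (refl , trans e (cong suc (sym (toℕ-mateFin y)))))))

  Before : Vertex m n → ℕ → ℕ → Set
  Before (x , y) i j = toℕ x < i ⊎ (toℕ x ≡ i × toℕ y < j)

  AgreesBefore : Dimer m n → ℕ → ℕ → Set
  AgreesBefore M i j = ∀ v → Before v i j → partner M v ≡ partner₀ v

  Before-partner₀ : ∀ {v i} t → Before v i (double t) → Before (partner₀ v) i (double t)
  Before-partner₀ t (inj₁ lt) = inj₁ lt
  Before-partner₀ {_ , y} t (inj₂ (e , lt)) =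
    inj₂ (e , subst (_< double t) (sym (toℕ-mateFin y)) (mate-< (toℕ y) t lt))

  module Sweep (ℓ : ℕ) where

    LocalProgress : Set
    LocalProgress = ∀ (M : Dimer m n) i t → i < m → suc (double t) < n → AgreesBefore M i (double t) →
      ∃₂ λ k M′ → 1 ≤ k × double t + double k ≤ n × Walk ℓ (double k) M M′ ×
                  AgreesBefore M′ i (double t + double k)

    module _ (progress : LocalProgress) where

      RowSweep : ℕ → ℕ → Set
      RowSweep i r = ∀ {t} {M : Dimer m n} → t + r ≡ h → AgreesBefore M i (double t) →
        ∃ λ M′ → Walk ℓ (double r) M M′ × AgreesBefore M′ i n

      sweep-row : ∀ {i} → i < m → ∀ r → RowSweep i r
      sweep-row {i} i<m = <-rec (RowSweep i) row
        where
        row : ∀ r → (∀ {r′} → r′ < r → RowSweep i r′) → RowSweep i r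
        row zero _ {t} {M} t≡h agrees =
          M , [ (λ v → refl) ] ,
          subst (AgreesBefore M i) (trans (cong double (trans (sym (+-identityʳ t)) t≡h)) (sym n≡)) agrees
        row (suc r) rec {t} {M} t+r≡h agrees
          with progress M i t i<m (subst (suc (double t) <_) (sym n≡) (double-<-suc t<h)) agrees
          where
          t<h : t < h
          t<h = subst (t <_) t+r≡h (m<m+n t (s≤s z≤n))
        ... | k , M′ , 1≤k , bound , walk , agrees′ with m≤n⇒∃[o]m+o≡n k≤1+r
          where
          k≤1+r : k ≤ suc r
          k≤1+r = double-cancel-≤ (+-cancelˡ-≤ (double t) _ _ (begin
            double t + double k       ≤⟨ bound ⟩
            n                         ≡⟨ n≡ ⟩
            double h                  ≡⟨ cong double (sym t+r≡h) ⟩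
            double (t + suc r)        ≡⟨ double-+ t (suc r) ⟩
            double t + double (suc r) ∎))
            where open ≤-Reasoning
        ... | r′ , k+r′≡1+r with rec (subst (r′ <_) k+r′≡1+r (m<n+m r′ 1≤k))
                                   (trans (+-assoc t k r′) (trans (cong (_+_ t) k+r′≡1+r) t+r≡h))
                                   (subst (AgreesBefore M′ i) (sym (double-+ t k)) agrees′)
        ... | M″ , walk′ , agrees″ =
          M″ ,
          subst (λ d → Walk ℓ d M M″) (trans (sym (double-+ k r′)) (cong double k+r′≡1+r)) (Walk-trans walk walk′) ,
          agrees″

      private
        next-row : ∀ {M i} → AgreesBefore M i n → AgreesBefore M (suc i) 0
        next-row agrees (x , y) (inj₁ x<1+i) with m≤n⇒m<n∨m≡n (≤-pred x<1+i)
        ... | inj₁ x<i = agrees (x , y) (inj₁ x<i)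
        ... | inj₂ x≡i = agrees (x , y) (inj₂ (x≡i , Fin.toℕ<n y))

        nothing-before-origin : ∀ {M} → AgreesBefore M 0 0
        nothing-before-origin v (inj₁ ())
        nothing-before-origin v (inj₂ (_ , ()))

      sweep : ∀ r {i} {M : Dimer m n} → i + r ≡ m → AgreesBefore M i 0 →
        ∃ λ M′ → Walk ℓ (r * n) M M′ × AgreesBefore M′ m 0
      sweep zero {i} {M} i≡m agrees =
        M , [ (λ v → refl) ] , subst (λ i → AgreesBefore M i 0) (trans (sym (+-identityʳ i)) i≡m) agrees
      sweep (suc r) {i} {M} i+r≡m agrees with sweep-row i<m h refl agrees
        where
        i<m : i < m
        i<m = subst (i <_) i+r≡m (m<m+n i (s≤s z≤n))
      ... | M′ , walk , agrees′ with sweep r (trans (sym (+-suc i r)) i+r≡m) (next-row {M′} agrees′)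
      ... | M″ , walk′ , agrees″ =
        M″ , subst (λ d → Walk ℓ (d + r * n) M M″) (sym n≡) (Walk-trans walk walk′) , agrees″

      walks-to-M₀ : ∀ M → Walk ℓ (m * n) M M₀
      walks-to-M₀ M with sweep m refl (nothing-before-origin {M})
      ... | M′ , walk , agrees = Walk-respʳ {M₂ = M′} walk (λ v → agrees v (inj₁ (Fin.toℕ<n (proj₁ v))))

-- Offsets and certificates

⊖-injectiveˡ : ∀ {a b} c → a ⊖ c ≡ b ⊖ c → a ≡ b
⊖-injectiveˡ {a} {b} c e = ℤ.+-injective (∙-cancelʳ (- + c) (+ a) (+ b)
  (trans (ℤ.[+m]-[+n]≡m⊖n a c) (trans e (sym (ℤ.[+m]-[+n]≡m⊖n b c)))))

⊖-suc : ∀ a c → suc a ⊖ c ≡ sucℤ (a ⊖ c)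
⊖-suc a c = sym (ℤ.distribʳ-⊖-+-pos 1 a c)

sign-⊖⇔< : ∀ {a c} → sign (a ⊖ c) ≡ Sign.- ⇔ a < c
sign-⊖⇔< {a} {c} = mk⇔ to ℤ.sign-⊖-<
  where
  to : sign (a ⊖ c) ≡ Sign.- → a < c
  to e with a <? c
  ... | yes a<c = a<c
  ... | no a≮c with trans (sym (cong sign (ℤ.≤-⊖ (≮⇒≥ a≮c)))) e
  ...   | ()

⊖≡0⇔≡ : ∀ {a c} → a ⊖ c ≡ 0ℤ ⇔ a ≡ c
⊖≡0⇔≡ {a} {c} = mk⇔ (λ e → ⊖-injectiveˡ c (trans e (sym (ℤ.n⊖n≡0 c)))) (λ { refl → ℤ.n⊖n≡0 a })

data Shift : Set where
  up down stay : Shift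

shift : Shift → ℤ → ℤ
shift up   = sucℤ
shift down = pred
shift stay = id

-- Oriented as the coordinate equations in Adj, so that Adj⇔Displaced is mere repackaging.
Shifted : Shift → ℕ → ℕ → Set
Shifted up   a b = b ≡ suc a
Shifted down a b = a ≡ suc b
Shifted stay a b = b ≡ a

Shifted⇔⊖ : ∀ s {a b} c → Shifted s a b ⇔ b ⊖ c ≡ shift s (a ⊖ c)
Shifted⇔⊖ up {a} {b} c = mk⇔
  (λ e → trans (cong (_⊖ c) e) (⊖-suc a c))
  (λ e → ⊖-injectiveˡ c (trans e (sym (⊖-suc a c))))
Shifted⇔⊖ down {a} {b} c = mk⇔
  (λ e → trans (sym (ℤ.pred-suc (b ⊖ c))) (cong pred (trans (sym (⊖-suc b c)) (cong (_⊖ c) (sym e)))))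
  (λ e → sym (⊖-injectiveˡ c (trans (⊖-suc b c) (trans (cong sucℤ e) (ℤ.suc-pred (a ⊖ c))))))
Shifted⇔⊖ stay c = mk⇔ (cong (_⊖ c)) (⊖-injectiveˡ c)

data Dir : Set where
  +x -x +y -y +x-y -x+y : Dir

shifts : Dir → Shift × Shift
shifts +x   = up   , stay
shifts -x   = down , stay
shifts +y   = stay , up
shifts -y   = stay , down
shifts +x-y = up   , down
shifts -x+y = down , up

Dir-all? : {P : Dir → Set} → (∀ d → Dec (P d)) → Dec (∀ d → P d)
Dir-all? P? = map′
  (λ { (p₁ , p₂ , p₃ , p₄ , p₅ , p₆) →
        λ { +x → p₁ ; -x → p₂ ; +y → p₃ ; -y → p₄ ; +x-y → p₅ ; -x+y → p₆ } })
  (λ p → p +x , p -x , p +y , p -y , p +x-y , p -x+y)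
  (P? +x ×-dec P? -x ×-dec P? +y ×-dec P? -y ×-dec P? +x-y ×-dec P? -x+y)

Dir-any? : {P : Dir → Set} → (∀ d → Dec (P d)) → Dec (∃ P)
Dir-any? P? = map′
  (λ { (inj₁ p) → +x , p ; (inj₂ (inj₁ p)) → -x , p ; (inj₂ (inj₂ (inj₁ p))) → +y , p
     ; (inj₂ (inj₂ (inj₂ (inj₁ p)))) → -y , p ; (inj₂ (inj₂ (inj₂ (inj₂ (inj₁ p))))) → +x-y , p
     ; (inj₂ (inj₂ (inj₂ (inj₂ (inj₂ p))))) → -x+y , p })
  (λ { (+x , p) → inj₁ p ; (-x , p) → inj₂ (inj₁ p) ; (+y , p) → inj₂ (inj₂ (inj₁ p))
     ; (-y , p) → inj₂ (inj₂ (inj₂ (inj₁ p))) ; (+x-y , p) → inj₂ (inj₂ (inj₂ (inj₂ (inj₁ p))))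
     ; (-x+y , p) → inj₂ (inj₂ (inj₂ (inj₂ (inj₂ p)))) })
  (P? +x ⊎-dec P? -x ⊎-dec P? +y ⊎-dec P? -y ⊎-dec P? +x-y ⊎-dec P? -x+y)

Offset : Set
Offset = ℤ × ℤ

_≟ₒ_ : DecidableEquality Offset
_≟ₒ_ = ≡-dec ℤ._≟_ ℤ._≟_

step : Dir → Offset → Offset
step d (dx , dy) = shift (proj₁ (shifts d)) dx , shift (proj₂ (shifts d)) dy

Displaced : ∀ {m n} → Dir → Vertex m n → Vertex m n → Set
Displaced d (x , y) (x′ , y′) =
  Shifted (proj₁ (shifts d)) (toℕ x) (toℕ x′) × Shifted (proj₂ (shifts d)) (toℕ y) (toℕ y′)

Adj⇔Displaced : ∀ {m n} {u v : Vertex m n} → Adj u v ⇔ ∃ λ d → Displaced d u v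
Adj⇔Displaced = mk⇔ to from
  where
  to : ∀ {u v} → Adj u v → ∃ λ d → Displaced d u v
  to (inj₁ p)                               = +x , p
  to (inj₂ (inj₁ p))                        = -x , p
  to (inj₂ (inj₂ (inj₁ p)))                 = +y , p
  to (inj₂ (inj₂ (inj₂ (inj₁ p))))          = -y , p
  to (inj₂ (inj₂ (inj₂ (inj₂ (inj₁ p)))))   = +x-y , p
  to (inj₂ (inj₂ (inj₂ (inj₂ (inj₂ p)))))   = -x+y , p
  from : ∀ {u v} → (∃ λ d → Displaced d u v) → Adj u v
  from (+x , p)   = inj₁ p
  from (-x , p)   = inj₂ (inj₁ p)
  from (+y , p)   = inj₂ (inj₂ (inj₁ p))
  from (-y , p)   = inj₂ (inj₂ (inj₂ (inj₁ p)))
  from (+x-y , p) = inj₂ (inj₂ (inj₂ (inj₂ (inj₁ p))))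
  from (-x+y , p) = inj₂ (inj₂ (inj₂ (inj₂ (inj₂ p))))

+-⊖ : ∀ c r → (c + r) ⊖ c ≡ + r
+-⊖ c r = trans (ℤ.≤-⊖ (m≤m+n c r)) (cong +_ (m+n∸m≡n c r))

⊖≡+⇒ : ∀ {a c r} → a ⊖ c ≡ + r → a ≡ c + r
⊖≡+⇒ {c = c} {r} e = ⊖-injectiveˡ c (trans e (sym (+-⊖ c r)))

Processed : Offset → Set
Processed (dx , dy) = sign dx ≡ Sign.- ⊎ (dx ≡ 0ℤ × sign dy ≡ Sign.-)

processed? : Decidable Processed
processed? (dx , dy) = (sign dx Sign.≟ Sign.-) ⊎-dec ((dx ℤ.≟ 0ℤ) ×-dec (sign dy Sign.≟ Sign.-))

Fact : Set
Fact = Offset × Offset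

_≟ᶠ_ : DecidableEquality Fact
_≟ᶠ_ = ≡-dec _≟ₒ_ _≟ₒ_

open import Data.List.Membership.DecPropositional _≟ᶠ_ using (_∈_; _∈?_)

Knowledge : Set
Knowledge = List Fact

-- The grid is a box, so an offset lies on it as soon as each of its coordinates is a coordinate of
-- a vertex known to exist: the sweep position, the one after it, or one occurring in a fact.
knownOffsets : Knowledge → List Offset
knownOffsets K = (0ℤ , 0ℤ) ∷ (0ℤ , 1ℤ) ∷ map proj₁ K

Located : Knowledge → Offset → Set
Located K (dx , dy) = Any ((dx ≡_) ∘ proj₁) (knownOffsets K) × Any ((dy ≡_) ∘ proj₂) (knownOffsets K)

located? : ∀ K → Decidable (Located K)
located? K (dx , dy) = Any.any? ((dx ℤ.≟_) ∘ proj₁) _ ×-dec Any.any? ((dy ℤ.≟_) ∘ proj₂) _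

Contradicted : Knowledge → Offset → Offset → Set
Contradicted K o o′ = Processed o′ ⊎ Any (λ f → proj₁ f ≡ o′ × proj₂ f ≢ o) K

contradicted? : ∀ K o o′ → Dec (Contradicted K o o′)
contradicted? K o o′ = processed? o′ ⊎-dec Any.any? (λ f → (proj₁ f ≟ₒ o′) ×-dec ¬? (proj₂ f ≟ₒ o)) K

learn : Offset → Offset → Knowledge → Knowledge
learn o o′ K = (o , o′) ∷ (o′ , o) ∷ K

module CycleOffsets {k : ℕ} (cycle : Vec Fact (suc (suc k))) where

  aₒ bₒ : Fin (suc (suc k)) → Offset
  aₒ x = proj₁ (lookup cycle x)
  bₒ x = proj₂ (lookup cycle x)

  ValidCycle : Knowledge → Set
  ValidCycle K =
      (∀ x → (aₒ x , bₒ x) ∈ K × ¬ Processed (aₒ x) × ¬ Processed (bₒ x) ×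
             ∃ λ d → aₒ (next x) ≡ step d (bₒ x))
    × (∀ x y → (aₒ x ≡ aₒ y → x ≡ y) × (bₒ x ≡ bₒ y → x ≡ y) × aₒ x ≢ bₒ y)

  validCycle? : ∀ K → Dec (ValidCycle K)
  validCycle? K =
        Fin.all? (λ x → (aₒ x , bₒ x) ∈? K ×-dec ¬? (processed? (aₒ x)) ×-dec ¬? (processed? (bₒ x))
                          ×-dec Dir-any? (λ d → aₒ (next x) ≟ₒ step d (bₒ x)))
    ×-dec Fin.all? (λ x → Fin.all? (λ y → ((aₒ x ≟ₒ aₒ y) →-dec (x Fin.≟ y))
                                   ×-dec ((bₒ x ≟ₒ bₒ y) →-dec (x Fin.≟ y)) ×-dec ¬? (aₒ x ≟ₒ bₒ y)))

  OnCycle : Offset → Set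
  OnCycle o = ∃ λ x → o ≡ aₒ x ⊎ o ≡ bₒ x

  onCycle? : Decidable OnCycle
  onCycle? o = Fin.any? (λ x → (o ≟ₒ aₒ x) ⊎-dec (o ≟ₒ bₒ x))

  afterSwitch : Knowledge → Knowledge
  afterSwitch K = tabulate (λ x → bₒ x , aₒ (next x)) ++ tabulate (λ x → aₒ (next x) , bₒ x)
                  ++ filter (¬? ∘ onCycle? ∘ proj₁) K

open CycleOffsets using (ValidCycle; validCycle?; afterSwitch)

verticalFact : ℕ → Fact
verticalFact s = (0ℤ , + double s) , (0ℤ , + suc (double s))

-- A certificate is a case analysis of the dimers near the sweep position, in offsets relative to
-- it; a fact (o , o′) records that the vertex at o is matched to the vertex at o′.  `query o`
-- branches on the direction of the dimer at o, `switch` switches an alternating cycle of known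
-- dimers, and `done k` claims agreement with M₀ on the next 2k positions of the row.
data Certificate : Set where
  impossible : Certificate
  query      : Offset → (Dir → Certificate) → Certificate
  switch     : ∀ k → Vec Fact (suc (suc k)) → Certificate → Certificate
  done       : ℕ → Certificate

-- u counts the switches made on the way to the current node.
Valid : ℕ → ℕ → Knowledge → Certificate → Set
Valid ℓ u K impossible         = ⊥
Valid ℓ u K (query o branch)   =
  (¬ Processed o × Located K o) × (∀ d → Contradicted K o (step d o) ⊎ Valid ℓ u (learn o (step d o) K) (branch d))
Valid ℓ u K (switch k cycle c) =
  (2 * suc (suc k) ≤ 2 * ℓ × ValidCycle cycle K) × Valid ℓ (suc u) (afterSwitch cycle K) c
Valid ℓ u K (done k)           = 1 ≤ k × u ≤ double k × (∀ (s : Fin k) → verticalFact (toℕ s) ∈ K)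

valid? : ∀ ℓ u K c → Dec (Valid ℓ u K c)
valid? ℓ u K impossible         = no id
valid? ℓ u K (query o branch)   =
  (¬? (processed? o) ×-dec located? K o) ×-dec
  Dir-all? (λ d → contradicted? K o (step d o) ⊎-dec valid? ℓ u (learn o (step d o) K) (branch d))
valid? ℓ u K (switch k cycle c) =
  (2 * suc (suc k) ≤? 2 * ℓ ×-dec validCycle? cycle K) ×-dec valid? ℓ (suc u) (afterSwitch cycle K) c
valid? ℓ u K (done k)           = 1 ≤? k ×-dec u ≤? double k ×-dec Fin.all? (λ s → verticalFact (toℕ s) ∈? K)

-- Soundness of certificates

module Semantics {m n h : ℕ} (n≡ : n ≡ double h) (ℓ : ℕ) {i t : ℕ} (i<m : i < m) (2t+1<n : suc (double t) < n) where

  open Reference {m} n≡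

  j : ℕ
  j = double t

  offset : Vertex m n → Offset
  offset (x , y) = toℕ x ⊖ i , toℕ y ⊖ j

  offset-injective : ∀ {u v} → offset u ≡ offset v → u ≡ v
  offset-injective e = cong₂ _,_
    (Fin.toℕ-injective (⊖-injectiveˡ i (proj₁ (,-injective e))))
    (Fin.toℕ-injective (⊖-injectiveˡ j (proj₂ (,-injective e))))

  Displaced⇔step : ∀ {d u v} → Displaced d u v ⇔ offset v ≡ step d (offset u)
  Displaced⇔step = mk⇔
    (λ (p , q) → cong₂ _,_ (Equivalence.to (Shifted⇔⊖ _ i) p) (Equivalence.to (Shifted⇔⊖ _ j) q))
    (λ e → Equivalence.from (Shifted⇔⊖ _ i) (proj₁ (,-injective e)) ,
           Equivalence.from (Shifted⇔⊖ _ j) (proj₂ (,-injective e)))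

  Adj⇒step : ∀ {u v} → Adj u v → ∃ λ d → offset v ≡ step d (offset u)
  Adj⇒step {u} {v} adj with Equivalence.to (Adj⇔Displaced {u = u} {v}) adj
  ... | d , p = d , Equivalence.to (Displaced⇔step {d} {u} {v}) p

  step⇒Adj : ∀ {d u v} → offset v ≡ step d (offset u) → Adj u v
  step⇒Adj {d} {u} {v} e =
    Equivalence.from (Adj⇔Displaced {u = u} {v}) (d , Equivalence.from (Displaced⇔step {d} {u} {v}) e)

  Before⇔Processed : ∀ v → Before v i j ⇔ Processed (offset v)
  Before⇔Processed (x , y) = mk⇔
    [ inj₁ ∘ Equivalence.from x<i , (λ (e , lt) → inj₂ (Equivalence.from x≡i e , Equivalence.from y<j lt)) ]′
    [ inj₁ ∘ Equivalence.to x<i , (λ (e , s) → inj₂ (Equivalence.to x≡i e , Equivalence.to y<j s)) ]′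
    where
    x<i : sign (toℕ x ⊖ i) ≡ Sign.- ⇔ toℕ x < i
    x<i = sign-⊖⇔<
    y<j : sign (toℕ y ⊖ j) ≡ Sign.- ⇔ toℕ y < j
    y<j = sign-⊖⇔<
    x≡i : toℕ x ⊖ i ≡ 0ℤ ⇔ toℕ x ≡ i
    x≡i = ⊖≡0⇔≡

  Exists : Offset → Set
  Exists o = ∃ λ v → offset v ≡ o

  Holds : Dimer m n → Fact → Set
  Holds M (o , o′) = ∃ λ v → offset v ≡ o × offset (partner M v) ≡ o′

  Holds-swap : ∀ {M o o′} → Holds M (o , o′) → Holds M (o′ , o)
  Holds-swap {M} (v , at , at′) = partner M v , at′ , trans (cong offset (involutive M v)) at

  Consistent : Dimer m n → Knowledge → Set
  Consistent M = All (Holds M)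

  known-exist : ∀ {M K} → Consistent M K → All Exists (knownOffsets K)
  known-exist con = ((x₀ , fromℕ< j<n) , cong₂ _,_ (at-index i<m) (at-index j<n))
                  ∷ ((x₀ , fromℕ< 2t+1<n) , cong₂ _,_ (at-index i<m) one-after)
                  ∷ map⁺ (All.map (λ (v , at , _) → v , at) con)
    where
    x₀ : Fin m
    x₀ = fromℕ< i<m
    j<n : j < n
    j<n = <-trans (n<1+n j) 2t+1<n
    at-index : ∀ {c N} (c<N : c < N) → toℕ (fromℕ< c<N) ⊖ c ≡ 0ℤ
    at-index {c} c<N = trans (cong (_⊖ c) (Fin.toℕ-fromℕ< c<N)) (ℤ.n⊖n≡0 c)
    one-after : toℕ (fromℕ< 2t+1<n) ⊖ j ≡ 1ℤ
    one-after = trans (cong (_⊖ j) (Fin.toℕ-fromℕ< 2t+1<n)) (trans (⊖-suc j j) (cong sucℤ (ℤ.n⊖n≡0 j)))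

  located-exists : ∀ {M K o} → Consistent M K → Located K o → Exists o
  located-exists {M} {o = _ , _} con (in-x , in-y)
    with All.lookupAny (known-exist {M} con) in-x | All.lookupAny (known-exist {M} con) in-y
  ... | ((x , _) , at) , p | ((_ , y) , at′) , q =
    (x , y) , cong₂ _,_ (trans (cong proj₁ at) (sym p)) (trans (cong proj₂ at′) (sym q))

  row-offset : ∀ {x y r} → toℕ x ≡ i → toℕ y ≡ j + r → offset (x , y) ≡ (0ℤ , + r)
  row-offset {r = r} x≡i y≡ = cong₂ _,_ (Equivalence.from ⊖≡0⇔≡ x≡i) (trans (cong (_⊖ j) y≡) (+-⊖ j r))

  partner₀-offset : ∀ {x y r} → toℕ x ≡ i → toℕ y ≡ j + r → offset (partner₀ (x , y)) ≡ (0ℤ , + mate r)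
  partner₀-offset {y = y} {r} x≡i y≡ = row-offset x≡i (trans (toℕ-mateFin y) (trans (cong mate y≡) (mate-double-+ t r)))

  vertical-Holds : ∀ {M s r} → r ≡ double s ⊎ r ≡ suc (double s) →
    Holds M (verticalFact s) → Holds M ((0ℤ , + r) , (0ℤ , + mate r))
  vertical-Holds {M} {s} (inj₁ refl) h =
    subst (λ q → Holds M ((0ℤ , + double s) , (0ℤ , + q))) (sym (mate-even s)) h
  vertical-Holds {M} {s} (inj₂ refl) h =
    subst (λ q → Holds M ((0ℤ , + suc (double s)) , (0ℤ , + q))) (sym (mate-odd s)) (Holds-swap {M} h)

  vertical-agrees : ∀ {M x y r} → toℕ x ≡ i → toℕ y ≡ j + r →
    Holds M ((0ℤ , + r) , (0ℤ , + mate r)) → partner M (x , y) ≡ partner₀ (x , y)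
  vertical-agrees x≡i y≡ (w , at , at′) with offset-injective (trans at (sym (row-offset x≡i y≡)))
  ... | refl = offset-injective (trans at′ (sym (partner₀-offset x≡i y≡)))

  module _ {M : Dimer m n} (agrees : AgreesBefore M i j) where

    partner-unprocessed : ∀ {v} → ¬ Processed (offset v) → ¬ Processed (offset (partner M v))
    partner-unprocessed {v} ¬proc proc = ¬proc (Equivalence.to (Before⇔Processed v)
      (subst (λ w → Before w i j) (trans (sym (agrees w w-before)) (involutive M v)) (Before-partner₀ t w-before)))
      where
      w : Vertex m n
      w = partner M v
      w-before : Before w i j
      w-before = Equivalence.from (Before⇔Processed w) proc

    uncontradicted : ∀ {K v} → Consistent M K → ¬ Processed (offset v) →
      ¬ Contradicted K (offset v) (offset (partner M v))
    uncontradicted con ¬proc (inj₁ proc) = partner-unprocessed ¬proc proc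
    uncontradicted {v = v} con ¬proc (inj₂ any) with All.lookupAny con any
    ... | (w , at , at′) , (e , ne) =
      ne (trans (sym at′) (trans (cong (offset ∘ partner M) w≡) (cong offset (involutive M v))))
      where
      w≡ : w ≡ partner M v
      w≡ = offset-injective (trans at e)

    module _ {k : ℕ} (cycle : Vec Fact (suc (suc k))) {K : Knowledge}
             (valid : ValidCycle cycle K) (con : Consistent M K) where
      open CycleOffsets cycle using (aₒ; bₒ; OnCycle; onCycle?)

      private
        dimerAt : ∀ x → Holds M (aₒ x , bₒ x)
        dimerAt x = All.lookup con (proj₁ (proj₁ valid x))

        av bv : Fin (suc (suc k)) → Vertex m n
        av x = proj₁ (dimerAt x)
        bv x = partner M (av x)

        av-at : ∀ x → offset (av x) ≡ aₒ x
        av-at x = proj₁ (proj₂ (dimerAt x))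

        bv-at : ∀ x → offset (bv x) ≡ bₒ x
        bv-at x = proj₂ (proj₂ (dimerAt x))

        distinct′ : ∀ {c c′} → [ av , bv ]′ c ≡ [ av , bv ]′ c′ → c ≡ c′
        distinct′ {inj₁ x} {inj₁ y} e =
          cong inj₁ (proj₁ (proj₂ valid x y) (trans (sym (av-at x)) (trans (cong offset e) (av-at y))))
        distinct′ {inj₁ x} {inj₂ y} e =
          ⊥-elim (proj₂ (proj₂ (proj₂ valid x y)) (trans (sym (av-at x)) (trans (cong offset e) (bv-at y))))
        distinct′ {inj₂ x} {inj₁ y} e =
          ⊥-elim (proj₂ (proj₂ (proj₂ valid y x)) (trans (sym (av-at y)) (trans (cong offset (sym e)) (bv-at x))))
        distinct′ {inj₂ x} {inj₂ y} e =
          cong inj₂ (proj₁ (proj₂ (proj₂ valid x y)) (trans (sym (bv-at x)) (trans (cong offset e) (bv-at y))))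

        adjBA′ : ∀ x → Adj (bv x) (av (next x))
        adjBA′ x = step⇒Adj {d} (trans (av-at (next x)) (trans e (cong (step d) (sym (bv-at x)))))
          where
          d : Dir
          d = proj₁ (proj₂ (proj₂ (proj₂ (proj₁ valid x))))
          e : aₒ (next x) ≡ step d (bₒ x)
          e = proj₂ (proj₂ (proj₂ (proj₂ (proj₁ valid x))))

        realised : Cycle m n k
        realised = record { a = av ; b = bv ; distinct = distinct′ ; adjAB = adjacent M ∘ av ; adjBA = adjBA′ }

        open Switching M realised (λ _ → refl)

        vert-unprocessed : ∀ c → ¬ Processed (offset (vert realised c))
        vert-unprocessed (inj₁ x) = subst (¬_ ∘ Processed) (sym (av-at x)) (proj₁ (proj₂ (proj₁ valid x)))
        vert-unprocessed (inj₂ x) = subst (¬_ ∘ Processed) (sym (bv-at x)) (proj₁ (proj₂ (proj₂ (proj₁ valid x))))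

        off-cycle : ∀ {v} → ¬ OnCycle (offset v) → ∀ c → vert realised c ≢ v
        off-cycle ¬on (inj₁ x) refl = ¬on (x , inj₁ (av-at x))
        off-cycle ¬on (inj₂ x) refl = ¬on (x , inj₂ (bv-at x))

        before-off-cycle : ∀ {v} → Before v i j → ∀ c → vert realised c ≢ v
        before-off-cycle {v} before c refl = vert-unprocessed c (Equivalence.to (Before⇔Processed v) before)

        partner′-b : ∀ x → partner switched (bv x) ≡ av (next x)
        partner′-b = proj₁ (proj₂ switched-Switch)

        partner′-off : ∀ v → (∀ c → vert realised c ≢ v) → partner switched v ≡ partner M v
        partner′-off = proj₂ (proj₂ switched-Switch)

        switched-edge : ∀ x → Holds switched (bₒ x , aₒ (next x))
        switched-edge x = bv x , bv-at x , trans (cong offset (partner′-b x)) (av-at (next x))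

        kept : ∀ {f} → Holds M f × ¬ OnCycle (proj₁ f) → Holds switched f
        kept ((v , at , at′) , ¬on) =
          v , at , trans (cong offset (partner′-off v (off-cycle (subst (¬_ ∘ OnCycle) (sym at) ¬on)))) at′

      switch-sound : 2 * suc (suc k) ≤ 2 * ℓ →
        ∃ λ M′ → Step ℓ M M′ × Consistent M′ (afterSwitch cycle K) × AgreesBefore M′ i j
      switch-sound len = switched , (k , len , realised , switched-Switch) , consistent′ , agrees′
        where
        consistent′ : Consistent switched (afterSwitch cycle K)
        consistent′ = ++⁺ (tabulate⁺ switched-edge) (++⁺ (tabulate⁺ (Holds-swap {switched} ∘ switched-edge))
          (All.zipWith kept (filter⁺ (¬? ∘ onCycle? ∘ proj₁) con , all-filter (¬? ∘ onCycle? ∘ proj₁) K)))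

        agrees′ : AgreesBefore switched i j
        agrees′ v before = trans (partner′-off v (before-off-cycle before)) (agrees v before)

    done-sound : ∀ {K k} → 1 ≤ k → (∀ (s : Fin k) → verticalFact (toℕ s) ∈ K) → Consistent M K →
      j + double k ≤ n × AgreesBefore M i (j + double k)
    done-sound {k = suc k} _ pairs con = bound , agrees′
      where
      pairAt : ∀ {s} → s < suc k → Holds M (verticalFact s)
      pairAt s<k = subst (Holds M ∘ verticalFact) (Fin.toℕ-fromℕ< s<k) (All.lookup con (pairs (fromℕ< s<k)))

      bound : j + double (suc k) ≤ n
      bound with pairAt (n<1+n k)
      ... | v , _ , at = subst (_≤ n) (sym (+-suc j (suc (double k))))
                           (subst (_< n) (⊖≡+⇒ (proj₂ (,-injective at))) (Fin.toℕ<n (proj₂ (partner M v))))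

      agrees′ : AgreesBefore M i (j + double (suc k))
      agrees′ v (inj₁ x<i) = agrees v (inj₁ x<i)
      agrees′ (x , y) (inj₂ (x≡i , y<)) with toℕ y <? j
      ... | yes y<j = agrees (x , y) (inj₂ (x≡i , y<j))
      ... | no y≮j with m≤n⇒∃[o]m+o≡n (≮⇒≥ y≮j)
      ... | r , j+r≡y with halve r (suc k) (+-cancelˡ-< j r _ (subst (_< j + double (suc k)) (sym j+r≡y) y<))
      ... | s , s<k , r≡ = vertical-agrees {M} x≡i (sym j+r≡y) (vertical-Holds {M} r≡ (pairAt s<k))

  Outcome : Dimer m n → ℕ → Set
  Outcome M u = ∃₂ λ k M′ → ∃ λ s →
    1 ≤ k × j + double k ≤ n × u + s ≤ double k × Walk ℓ s M M′ × AgreesBefore M′ i (j + double k)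

  Outcome-cons : ∀ {u M M′} → Step ℓ M M′ → Outcome M′ (suc u) → Outcome M u
  Outcome-cons {u} st (k , M″ , s , 1≤k , bound , u+s≤ , walk , agrees) =
    k , M″ , suc s , 1≤k , bound , subst (_≤ double k) (sym (+-suc u s)) u+s≤ , st ∷ walk , agrees

  sound : ∀ c {u K M} → Valid ℓ u K c → Consistent M K → AgreesBefore M i j → Outcome M u
  sound (query o branch) {K = K} {M} ((¬proc , loc) , branches) con agrees =
    [ (λ contra → ⊥-elim (uncontradicted {M} agrees con ¬proc′ (subst₂ (Contradicted K) (sym v-at) (sym w-at) contra)))
    , (λ valid → sound (branch d) valid ((v , v-at , w-at) ∷ Holds-swap {M} (v , v-at , w-at) ∷ con) agrees)
    ]′ (branches d)
    where
    v : Vertex m n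
    v = proj₁ (located-exists {M} con loc)
    v-at : offset v ≡ o
    v-at = proj₂ (located-exists {M} con loc)
    ¬proc′ : ¬ Processed (offset v)
    ¬proc′ = subst (¬_ ∘ Processed) (sym v-at) ¬proc
    d : Dir
    d = proj₁ (Adj⇒step (adjacent M v))
    w-at : offset (partner M v) ≡ step d o
    w-at = trans (proj₂ (Adj⇒step (adjacent M v))) (cong (step d) v-at)
  sound (switch k cycle c) {M = M} ((len , validCycle) , valid) con agrees =
    let M′ , st , con′ , agrees′ = switch-sound {M} agrees cycle validCycle con len
    in Outcome-cons {M = M} {M′} st (sound c valid con′ agrees′)
  sound (done k) {u} {M = M} (1≤k , u≤ , pairs) con agrees =
    let bound , agrees′ = done-sound {M} agrees 1≤k pairs con
    in k , M , 0 , 1≤k , bound , subst (_≤ double k) (sym (+-identityʳ u)) u≤ , [ (λ v → refl) ] , agrees′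

  progress : ∀ c → Valid ℓ 0 [] c → ∀ M → AgreesBefore M i j →
    ∃₂ λ k M′ → 1 ≤ k × j + double k ≤ n × Walk ℓ (double k) M M′ × AgreesBefore M′ i (j + double k)
  progress c valid M agrees with sound c valid [] agrees
  ... | k , M′ , s , 1≤k , bound , s≤ , walk , agrees′ = k , M′ , 1≤k , bound , Walk-mono s≤ walk , agrees′

-- The certificate

ask : Offset → (t₁ t₂ t₃ t₄ t₅ t₆ : Certificate) → Certificate
ask o t₁ t₂ t₃ t₄ t₅ t₆ = query o λ { +x → t₁ ; -x → t₂ ; +y → t₃ ; -y → t₄ ; +x-y → t₅ ; -x+y → t₆ }

switch₄ : (a₀ b₀ a₁ b₁ : Offset) → Certificate → Certificate
switch₄ a₀ b₀ a₁ b₁ = switch 0 ((a₀ , b₀) ∷ (a₁ , b₁) ∷ [])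

switch₆ : (a₀ b₀ a₁ b₁ a₂ b₂ : Offset) → Certificate → Certificate
switch₆ a₀ b₀ a₁ b₁ a₂ b₂ = switch 1 ((a₀ , b₀) ∷ (a₁ , b₁) ∷ (a₂ , b₂) ∷ [])

certificate : Certificate
certificate =
  (ask (+ 0 , + 0)
    (ask (+ 1 , + 1)
      (ask (+ 2 , + 0)
        (ask (+ 0 , + 1) impossible impossible
          (switch₄ (+ 1 , + 1) (+ 2 , + 1) (+ 3 , + 0) (+ 2 , + 0)
            (switch₆ (+ 0 , + 0) (+ 1 , + 0) (+ 2 , + 0) (+ 1 , + 1) (+ 0 , + 2) (+ 0 , + 1)
              (done 1)))
          impossible
          impossible
          impossible)
        impossible
        impossible
        (ask (+ 0 , + 1) impossible impossible
          (ask (+ 1 , + 2)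
            (switch₄ (+ 1 , + 2) (+ 2 , + 2) (+ 2 , + 1) (+ 1 , + 1)
              (switch₆ (+ 0 , + 0) (+ 1 , + 0) (+ 1 , + 1) (+ 1 , + 2) (+ 0 , + 2) (+ 0 , + 1)
                (done 1)))
            impossible
            (ask (+ 2 , + 3)
              (ask (+ 3 , + 1)
                (ask (+ 3 , -[1+ 0 ])
                  (ask (+ 0 , + 3) impossible impossible
                    (switch₄ (+ 0 , + 4) (+ 0 , + 3) (+ 1 , + 2) (+ 1 , + 3)
                      (switch₆ (+ 0 , + 2) (+ 0 , + 1) (+ 1 , + 1) (+ 2 , + 1) (+ 1 , + 2) (+ 0 , + 3)
                        (switch₄ (+ 0 , + 0) (+ 1 , + 0) (+ 1 , + 1) (+ 0 , + 1) (done 2))))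
                    impossible
                    impossible
                    impossible)
                  impossible
                  (switch₆ (+ 2 , + 0) (+ 2 , -[1+ 0 ]) (+ 3 , -[1+ 0 ]) (+ 3 , + 0) (+ 2 , + 1) (+ 1 , + 1)
                    (switch₆ (+ 0 , + 0) (+ 1 , + 0) (+ 2 , + 0) (+ 1 , + 1) (+ 0 , + 2) (+ 0 , + 1)
                      (done 1)))
                  (ask (+ 0 , + 3) impossible impossible
                    (switch₄ (+ 0 , + 4) (+ 0 , + 3) (+ 1 , + 2) (+ 1 , + 3)
                      (switch₆ (+ 0 , + 2) (+ 0 , + 1) (+ 1 , + 1) (+ 2 , + 1) (+ 1 , + 2) (+ 0 , + 3)
                        (switch₄ (+ 0 , + 0) (+ 1 , + 0) (+ 1 , + 1) (+ 0 , + 1) (done 2))))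
                    impossible
                    impossible
                    impossible)
                  (ask (+ 0 , + 3) impossible impossible
                    (switch₄ (+ 0 , + 4) (+ 0 , + 3) (+ 1 , + 2) (+ 1 , + 3)
                      (switch₆ (+ 0 , + 2) (+ 0 , + 1) (+ 1 , + 1) (+ 2 , + 1) (+ 1 , + 2) (+ 0 , + 3)
                        (switch₄ (+ 0 , + 0) (+ 1 , + 0) (+ 1 , + 1) (+ 0 , + 1) (done 2))))
                    impossible
                    impossible
                    impossible)
                  impossible)
                impossible
                (ask (+ 2 , + 2) impossible impossible impossible impossible impossible impossible)
                (ask (+ 0 , + 3) impossible impossible
                  (switch₄ (+ 0 , + 4) (+ 0 , + 3) (+ 1 , + 2) (+ 1 , + 3)
                    (switch₆ (+ 0 , + 2) (+ 0 , + 1) (+ 1 , + 1) (+ 2 , + 1) (+ 1 , + 2) (+ 0 , + 3)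
                      (switch₄ (+ 0 , + 0) (+ 1 , + 0) (+ 1 , + 1) (+ 0 , + 1) (done 2))))
                  impossible
                  impossible
                  impossible)
                (ask (+ 3 , -[1+ 0 ])
                  (ask (+ 3 , + 0) impossible impossible impossible impossible impossible impossible)
                  impossible
                  (switch₆ (+ 2 , + 0) (+ 2 , -[1+ 0 ]) (+ 3 , -[1+ 0 ]) (+ 3 , + 0) (+ 2 , + 1) (+ 1 , + 1)
                    (switch₆ (+ 0 , + 0) (+ 1 , + 0) (+ 2 , + 0) (+ 1 , + 1) (+ 0 , + 2) (+ 0 , + 1)
                      (done 1)))
                  (ask (+ 0 , + 3) impossible impossible
                    (switch₄ (+ 0 , + 4) (+ 0 , + 3) (+ 1 , + 2) (+ 1 , + 3)
                      (switch₆ (+ 0 , + 2) (+ 0 , + 1) (+ 1 , + 1) (+ 2 , + 1) (+ 1 , + 2) (+ 0 , + 3)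
                        (switch₄ (+ 0 , + 0) (+ 1 , + 0) (+ 1 , + 1) (+ 0 , + 1) (done 2))))
                    impossible
                    impossible
                    impossible)
                  (ask (+ 0 , + 3) impossible impossible
                    (switch₄ (+ 0 , + 4) (+ 0 , + 3) (+ 1 , + 2) (+ 1 , + 3)
                      (switch₆ (+ 0 , + 2) (+ 0 , + 1) (+ 1 , + 1) (+ 2 , + 1) (+ 1 , + 2) (+ 0 , + 3)
                        (switch₄ (+ 0 , + 0) (+ 1 , + 0) (+ 1 , + 1) (+ 0 , + 1) (done 2))))
                    impossible
                    impossible
                    impossible)
                  impossible)
                (switch₆ (+ 1 , + 1) (+ 2 , + 1) (+ 3 , + 1) (+ 2 , + 2) (+ 1 , + 3) (+ 1 , + 2)
                  (switch₆ (+ 0 , + 0) (+ 1 , + 0) (+ 1 , + 1) (+ 1 , + 2) (+ 0 , + 2) (+ 0 , + 1)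
                    (done 1))))
              impossible
              (ask (+ 2 , + 2)
                (ask (+ 3 , -[1+ 0 ])
                  (ask (+ 0 , + 4)
                    (ask (+ 0 , + 3) impossible impossible impossible impossible impossible impossible)
                    impossible
                    (ask (+ 0 , + 3) impossible impossible impossible impossible impossible impossible)
                    (switch₄ (+ 0 , + 4) (+ 0 , + 3) (+ 1 , + 2) (+ 1 , + 3)
                      (switch₆ (+ 0 , + 2) (+ 0 , + 1) (+ 1 , + 1) (+ 2 , + 1) (+ 1 , + 2) (+ 0 , + 3)
                        (switch₄ (+ 0 , + 0) (+ 1 , + 0) (+ 1 , + 1) (+ 0 , + 1) (done 2))))
                    impossible
                    impossible)
                  impossible
                  (switch₆ (+ 2 , + 0) (+ 2 , -[1+ 0 ]) (+ 3 , -[1+ 0 ]) (+ 3 , + 0) (+ 2 , + 1) (+ 1 , + 1)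
                    (switch₆ (+ 0 , + 0) (+ 1 , + 0) (+ 2 , + 0) (+ 1 , + 1) (+ 0 , + 2) (+ 0 , + 1)
                      (done 1)))
                  (ask (+ 0 , + 4)
                    (ask (+ 0 , + 3) impossible impossible impossible impossible impossible impossible)
                    impossible
                    (ask (+ 0 , + 3) impossible impossible impossible impossible impossible impossible)
                    (switch₄ (+ 0 , + 4) (+ 0 , + 3) (+ 1 , + 2) (+ 1 , + 3)
                      (switch₆ (+ 0 , + 2) (+ 0 , + 1) (+ 1 , + 1) (+ 2 , + 1) (+ 1 , + 2) (+ 0 , + 3)
                        (switch₄ (+ 0 , + 0) (+ 1 , + 0) (+ 1 , + 1) (+ 0 , + 1) (done 2))))
                    impossible
                    impossible)
                  (ask (+ 0 , + 4)
                    (ask (+ 0 , + 3) impossible impossible impossible impossible impossible impossible)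
                    impossible
                    (ask (+ 0 , + 3) impossible impossible impossible impossible impossible impossible)
                    (switch₄ (+ 0 , + 4) (+ 0 , + 3) (+ 1 , + 2) (+ 1 , + 3)
                      (switch₆ (+ 0 , + 2) (+ 0 , + 1) (+ 1 , + 1) (+ 2 , + 1) (+ 1 , + 2) (+ 0 , + 3)
                        (switch₄ (+ 0 , + 0) (+ 1 , + 0) (+ 1 , + 1) (+ 0 , + 1) (done 2))))
                    impossible
                    impossible)
                  impossible)
                impossible
                impossible
                impossible
                (switch₆ (+ 1 , + 1) (+ 2 , + 1) (+ 3 , + 1) (+ 2 , + 2) (+ 1 , + 3) (+ 1 , + 2)
                  (switch₆ (+ 0 , + 0) (+ 1 , + 0) (+ 1 , + 1) (+ 1 , + 2) (+ 0 , + 2) (+ 0 , + 1)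
                    (done 1)))
                impossible)
              (switch₆ (+ 1 , + 2) (+ 1 , + 3) (+ 2 , + 3) (+ 2 , + 2) (+ 2 , + 1) (+ 1 , + 1)
                (switch₆ (+ 0 , + 0) (+ 1 , + 0) (+ 1 , + 1) (+ 1 , + 2) (+ 0 , + 2) (+ 0 , + 1)
                  (done 1)))
              (ask (+ 3 , + 1)
                (ask (+ 2 , + 2) impossible impossible impossible impossible impossible impossible)
                impossible
                impossible
                (ask (+ 2 , + 2) impossible impossible impossible impossible impossible impossible)
                (ask (+ 2 , + 2) impossible impossible impossible impossible impossible impossible)
                (switch₆ (+ 1 , + 1) (+ 2 , + 1) (+ 3 , + 1) (+ 2 , + 2) (+ 1 , + 3) (+ 1 , + 2)
                  (switch₆ (+ 0 , + 0) (+ 1 , + 0) (+ 1 , + 1) (+ 1 , + 2) (+ 0 , + 2) (+ 0 , + 1)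
                    (done 1))))
              (ask (+ 2 , + 2)
                (ask (+ 3 , -[1+ 0 ])
                  (ask (+ 0 , + 4) impossible impossible
                    (ask (+ 0 , + 3) impossible impossible impossible impossible impossible impossible)
                    (switch₄ (+ 0 , + 4) (+ 0 , + 3) (+ 1 , + 2) (+ 1 , + 3)
                      (switch₆ (+ 0 , + 2) (+ 0 , + 1) (+ 1 , + 1) (+ 2 , + 1) (+ 1 , + 2) (+ 0 , + 3)
                        (switch₄ (+ 0 , + 0) (+ 1 , + 0) (+ 1 , + 1) (+ 0 , + 1) (done 2))))
                    impossible
                    impossible)
                  impossible
                  (switch₆ (+ 2 , + 0) (+ 2 , -[1+ 0 ]) (+ 3 , -[1+ 0 ]) (+ 3 , + 0) (+ 2 , + 1) (+ 1 , + 1)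
                    (switch₆ (+ 0 , + 0) (+ 1 , + 0) (+ 2 , + 0) (+ 1 , + 1) (+ 0 , + 2) (+ 0 , + 1)
                      (done 1)))
                  (ask (+ 0 , + 4) impossible impossible
                    (ask (+ 0 , + 3) impossible impossible impossible impossible impossible impossible)
                    (switch₄ (+ 0 , + 4) (+ 0 , + 3) (+ 1 , + 2) (+ 1 , + 3)
                      (switch₆ (+ 0 , + 2) (+ 0 , + 1) (+ 1 , + 1) (+ 2 , + 1) (+ 1 , + 2) (+ 0 , + 3)
                        (switch₄ (+ 0 , + 0) (+ 1 , + 0) (+ 1 , + 1) (+ 0 , + 1) (done 2))))
                    impossible
                    impossible)
                  (ask (+ 0 , + 4) impossible impossible
                    (ask (+ 0 , + 3) impossible impossible impossible impossible impossible impossible)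
                    (switch₄ (+ 0 , + 4) (+ 0 , + 3) (+ 1 , + 2) (+ 1 , + 3)
                      (switch₆ (+ 0 , + 2) (+ 0 , + 1) (+ 1 , + 1) (+ 2 , + 1) (+ 1 , + 2) (+ 0 , + 3)
                        (switch₄ (+ 0 , + 0) (+ 1 , + 0) (+ 1 , + 1) (+ 0 , + 1) (done 2))))
                    impossible
                    impossible)
                  impossible)
                impossible
                impossible
                impossible
                (switch₆ (+ 1 , + 1) (+ 2 , + 1) (+ 3 , + 1) (+ 2 , + 2) (+ 1 , + 3) (+ 1 , + 2)
                  (switch₆ (+ 0 , + 0) (+ 1 , + 0) (+ 1 , + 1) (+ 1 , + 2) (+ 0 , + 2) (+ 0 , + 1)
                    (done 1)))
                impossible))
            impossible
            impossible
            (switch₆ (+ 0 , + 1) (+ 0 , + 2) (+ 0 , + 3) (+ 1 , + 2) (+ 2 , + 1) (+ 1 , + 1)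
              (switch₄ (+ 0 , + 0) (+ 1 , + 0) (+ 1 , + 1) (+ 0 , + 1) (done 1))))
          impossible
          impossible
          impossible)
        (ask (+ 0 , + 1) impossible impossible
          (ask (+ 1 , + 2)
            (switch₄ (+ 1 , + 2) (+ 2 , + 2) (+ 2 , + 1) (+ 1 , + 1)
              (switch₆ (+ 0 , + 0) (+ 1 , + 0) (+ 1 , + 1) (+ 1 , + 2) (+ 0 , + 2) (+ 0 , + 1)
                (done 1)))
            impossible
            (ask (+ 2 , + 3)
              (ask (+ 3 , + 0)
                (ask (+ 3 , + 1)
                  (ask (+ 0 , + 3) impossible impossible
                    (switch₄ (+ 0 , + 4) (+ 0 , + 3) (+ 1 , + 2) (+ 1 , + 3)
                      (switch₆ (+ 0 , + 2) (+ 0 , + 1) (+ 1 , + 1) (+ 2 , + 1) (+ 1 , + 2) (+ 0 , + 3)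
                        (switch₄ (+ 0 , + 0) (+ 1 , + 0) (+ 1 , + 1) (+ 0 , + 1) (done 2))))
                    impossible
                    impossible
                    impossible)
                  impossible
                  (ask (+ 2 , + 2) impossible impossible impossible impossible impossible impossible)
                  impossible
                  impossible
                  (switch₆ (+ 1 , + 1) (+ 2 , + 1) (+ 3 , + 1) (+ 2 , + 2) (+ 1 , + 3) (+ 1 , + 2)
                    (switch₆ (+ 0 , + 0) (+ 1 , + 0) (+ 1 , + 1) (+ 1 , + 2) (+ 0 , + 2) (+ 0 , + 1)
                      (done 1))))
                impossible
                (switch₆ (+ 2 , + 0) (+ 3 , -[1+ 0 ]) (+ 3 , + 0) (+ 3 , + 1) (+ 2 , + 1) (+ 1 , + 1)
                  (switch₆ (+ 0 , + 0) (+ 1 , + 0) (+ 2 , + 0) (+ 1 , + 1) (+ 0 , + 2) (+ 0 , + 1)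
                    (done 1)))
                impossible
                (switch₆ (+ 1 , + 1) (+ 2 , + 1) (+ 3 , + 0) (+ 4 , -[1+ 0 ]) (+ 3 , -[1+ 0 ]) (+ 2 , + 0)
                  (switch₆ (+ 0 , + 0) (+ 1 , + 0) (+ 2 , + 0) (+ 1 , + 1) (+ 0 , + 2) (+ 0 , + 1)
                    (done 1)))
                impossible)
              impossible
              (ask (+ 3 , + 0)
                (ask (+ 3 , + 1)
                  (ask (+ 0 , + 4)
                    (ask (+ 0 , + 3) impossible impossible impossible impossible impossible impossible)
                    impossible
                    (ask (+ 0 , + 3) impossible impossible impossible impossible impossible impossible)
                    (switch₄ (+ 0 , + 4) (+ 0 , + 3) (+ 1 , + 2) (+ 1 , + 3)
                      (switch₆ (+ 0 , + 2) (+ 0 , + 1) (+ 1 , + 1) (+ 2 , + 1) (+ 1 , + 2) (+ 0 , + 3)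
                        (switch₄ (+ 0 , + 0) (+ 1 , + 0) (+ 1 , + 1) (+ 0 , + 1) (done 2))))
                    impossible
                    impossible)
                  impossible
                  (ask (+ 2 , + 2) impossible impossible impossible impossible impossible impossible)
                  impossible
                  impossible
                  (switch₆ (+ 1 , + 1) (+ 2 , + 1) (+ 3 , + 1) (+ 2 , + 2) (+ 1 , + 3) (+ 1 , + 2)
                    (switch₆ (+ 0 , + 0) (+ 1 , + 0) (+ 1 , + 1) (+ 1 , + 2) (+ 0 , + 2) (+ 0 , + 1)
                      (done 1))))
                impossible
                (switch₆ (+ 2 , + 0) (+ 3 , -[1+ 0 ]) (+ 3 , + 0) (+ 3 , + 1) (+ 2 , + 1) (+ 1 , + 1)
                  (switch₆ (+ 0 , + 0) (+ 1 , + 0) (+ 2 , + 0) (+ 1 , + 1) (+ 0 , + 2) (+ 0 , + 1)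
                    (done 1)))
                impossible
                (switch₆ (+ 1 , + 1) (+ 2 , + 1) (+ 3 , + 0) (+ 4 , -[1+ 0 ]) (+ 3 , -[1+ 0 ]) (+ 2 , + 0)
                  (switch₆ (+ 0 , + 0) (+ 1 , + 0) (+ 2 , + 0) (+ 1 , + 1) (+ 0 , + 2) (+ 0 , + 1)
                    (done 1)))
                impossible)
              (switch₆ (+ 1 , + 2) (+ 1 , + 3) (+ 2 , + 3) (+ 2 , + 2) (+ 2 , + 1) (+ 1 , + 1)
                (switch₆ (+ 0 , + 0) (+ 1 , + 0) (+ 1 , + 1) (+ 1 , + 2) (+ 0 , + 2) (+ 0 , + 1)
                  (done 1)))
              (ask (+ 3 , + 0)
                (ask (+ 3 , + 1)
                  (ask (+ 2 , + 2) impossible impossible impossible impossible impossible impossible)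
                  impossible
                  impossible
                  impossible
                  impossible
                  (switch₆ (+ 1 , + 1) (+ 2 , + 1) (+ 3 , + 1) (+ 2 , + 2) (+ 1 , + 3) (+ 1 , + 2)
                    (switch₆ (+ 0 , + 0) (+ 1 , + 0) (+ 1 , + 1) (+ 1 , + 2) (+ 0 , + 2) (+ 0 , + 1)
                      (done 1))))
                impossible
                (ask (+ 2 , + 2) impossible impossible impossible impossible impossible impossible)
                impossible
                (switch₆ (+ 1 , + 1) (+ 2 , + 1) (+ 3 , + 0) (+ 4 , -[1+ 0 ]) (+ 3 , -[1+ 0 ]) (+ 2 , + 0)
                  (switch₆ (+ 0 , + 0) (+ 1 , + 0) (+ 2 , + 0) (+ 1 , + 1) (+ 0 , + 2) (+ 0 , + 1)
                    (done 1)))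
                impossible)
              (ask (+ 3 , + 0)
                (ask (+ 3 , + 1)
                  (ask (+ 0 , + 4) impossible impossible
                    (ask (+ 0 , + 3) impossible impossible impossible impossible impossible impossible)
                    (switch₄ (+ 0 , + 4) (+ 0 , + 3) (+ 1 , + 2) (+ 1 , + 3)
                      (switch₆ (+ 0 , + 2) (+ 0 , + 1) (+ 1 , + 1) (+ 2 , + 1) (+ 1 , + 2) (+ 0 , + 3)
                        (switch₄ (+ 0 , + 0) (+ 1 , + 0) (+ 1 , + 1) (+ 0 , + 1) (done 2))))
                    impossible
                    impossible)
                  impossible
                  (ask (+ 2 , + 2) impossible impossible impossible impossible impossible impossible)
                  impossible
                  impossible
                  (switch₆ (+ 1 , + 1) (+ 2 , + 1) (+ 3 , + 1) (+ 2 , + 2) (+ 1 , + 3) (+ 1 , + 2)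
                    (switch₆ (+ 0 , + 0) (+ 1 , + 0) (+ 1 , + 1) (+ 1 , + 2) (+ 0 , + 2) (+ 0 , + 1)
                      (done 1))))
                impossible
                (switch₆ (+ 2 , + 0) (+ 3 , -[1+ 0 ]) (+ 3 , + 0) (+ 3 , + 1) (+ 2 , + 1) (+ 1 , + 1)
                  (switch₆ (+ 0 , + 0) (+ 1 , + 0) (+ 2 , + 0) (+ 1 , + 1) (+ 0 , + 2) (+ 0 , + 1)
                    (done 1)))
                impossible
                (switch₆ (+ 1 , + 1) (+ 2 , + 1) (+ 3 , + 0) (+ 4 , -[1+ 0 ]) (+ 3 , -[1+ 0 ]) (+ 2 , + 0)
                  (switch₆ (+ 0 , + 0) (+ 1 , + 0) (+ 2 , + 0) (+ 1 , + 1) (+ 0 , + 2) (+ 0 , + 1)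
                    (done 1)))
                impossible))
            impossible
            impossible
            (switch₆ (+ 0 , + 1) (+ 0 , + 2) (+ 0 , + 3) (+ 1 , + 2) (+ 2 , + 1) (+ 1 , + 1)
              (switch₄ (+ 0 , + 0) (+ 1 , + 0) (+ 1 , + 1) (+ 0 , + 1) (done 1))))
          impossible
          impossible
          impossible)
        impossible)
      (switch₄ (+ 0 , + 0) (+ 1 , + 0) (+ 1 , + 1) (+ 0 , + 1) (done 1))
      (ask (+ 0 , + 2) impossible impossible
        (ask (+ 0 , + 1) impossible impossible impossible impossible impossible impossible)
        (switch₆ (+ 0 , + 0) (+ 1 , + 0) (+ 1 , + 1) (+ 1 , + 2) (+ 0 , + 2) (+ 0 , + 1) (done 1))
        impossible
        impossible)
      impossible
      (ask (+ 0 , + 1) impossible impossible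
        (switch₆ (+ 0 , + 0) (+ 1 , + 0) (+ 2 , + 0) (+ 1 , + 1) (+ 0 , + 2) (+ 0 , + 1) (done 1))
        impossible
        impossible
        impossible)
      (ask (+ 0 , + 1) impossible impossible impossible impossible impossible impossible))
    impossible
    (done 1)
    impossible
    (ask (+ 1 , + 0)
      (ask (+ 1 , + 1)
        (ask (+ 0 , + 1) impossible impossible
          (switch₆ (+ 0 , + 1) (+ 0 , + 2) (+ 1 , + 1) (+ 2 , + 1) (+ 2 , + 0) (+ 1 , + 0)
            (switch₄ (+ 0 , + 0) (+ 1 , -[1+ 0 ]) (+ 1 , + 0) (+ 0 , + 1) (done 1)))
          impossible
          impossible
          impossible)
        (switch₆ (+ 0 , + 0) (+ 1 , -[1+ 0 ]) (+ 1 , + 0) (+ 2 , + 0) (+ 1 , + 1) (+ 0 , + 1)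
          (done 1))
        (ask (+ 0 , + 1) impossible impossible
          (switch₆ (+ 0 , + 1) (+ 0 , + 2) (+ 1 , + 2) (+ 1 , + 1) (+ 2 , + 0) (+ 1 , + 0)
            (switch₄ (+ 0 , + 0) (+ 1 , -[1+ 0 ]) (+ 1 , + 0) (+ 0 , + 1) (done 1)))
          impossible
          impossible
          impossible)
        impossible
        impossible
        (ask (+ 0 , + 1) impossible impossible impossible impossible impossible impossible))
      impossible
      (ask (+ 0 , + 1) impossible impossible
        (switch₆ (+ 0 , + 0) (+ 1 , -[1+ 0 ]) (+ 1 , + 0) (+ 1 , + 1) (+ 0 , + 2) (+ 0 , + 1)
          (done 1))
        impossible
        impossible
        impossible)
      impossible
      (ask (+ 1 , + 1)
        (ask (+ 2 , + 0)
          (ask (+ 0 , + 1) impossible impossible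
            (ask (+ 1 , + 2)
              (switch₆ (+ 1 , + 1) (+ 2 , + 1) (+ 3 , + 0) (+ 2 , + 0) (+ 2 , -[1+ 0 ]) (+ 1 , + 0)
                (switch₆ (+ 0 , + 0) (+ 1 , -[1+ 0 ]) (+ 1 , + 0) (+ 1 , + 1) (+ 0 , + 2) (+ 0 , + 1)
                  (done 1)))
              impossible
              (switch₆ (+ 1 , + 1) (+ 2 , + 1) (+ 3 , + 0) (+ 2 , + 0) (+ 2 , -[1+ 0 ]) (+ 1 , + 0)
                (switch₆ (+ 0 , + 0) (+ 1 , -[1+ 0 ]) (+ 1 , + 0) (+ 1 , + 1) (+ 0 , + 2) (+ 0 , + 1)
                  (done 1)))
              impossible
              impossible
              (switch₆ (+ 0 , + 1) (+ 0 , + 2) (+ 0 , + 3) (+ 1 , + 2) (+ 2 , + 1) (+ 1 , + 1)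
                (switch₆ (+ 0 , + 0) (+ 1 , -[1+ 0 ]) (+ 2 , -[1+ 0 ]) (+ 1 , + 0) (+ 1 , + 1) (+ 0 , + 1)
                  (done 1))))
            impossible
            impossible
            impossible)
          impossible
          impossible
          impossible
          (ask (+ 0 , + 1) impossible impossible
            (switch₆ (+ 1 , + 0) (+ 2 , -[1+ 0 ]) (+ 3 , -[1+ 0 ]) (+ 2 , + 0) (+ 2 , + 1) (+ 1 , + 1)
              (switch₆ (+ 0 , + 0) (+ 1 , -[1+ 0 ]) (+ 1 , + 0) (+ 1 , + 1) (+ 0 , + 2) (+ 0 , + 1)
                (done 1)))
            impossible
            impossible
            impossible)
          impossible)
        (switch₆ (+ 0 , + 0) (+ 1 , -[1+ 0 ]) (+ 2 , -[1+ 0 ]) (+ 1 , + 0) (+ 1 , + 1) (+ 0 , + 1)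
          (done 1))
        (ask (+ 0 , + 2) impossible impossible
          (ask (+ 0 , + 1) impossible impossible impossible impossible impossible impossible)
          (switch₄ (+ 0 , + 0) (+ 1 , -[1+ 0 ]) (+ 2 , -[1+ 0 ]) (+ 1 , + 0)
            (switch₆ (+ 0 , + 0) (+ 1 , + 0) (+ 1 , + 1) (+ 1 , + 2) (+ 0 , + 2) (+ 0 , + 1)
              (done 1)))
          impossible
          impossible)
        impossible
        (ask (+ 0 , + 1) impossible impossible
          (switch₆ (+ 0 , + 2) (+ 0 , + 1) (+ 1 , + 0) (+ 2 , -[1+ 0 ]) (+ 2 , + 0) (+ 1 , + 1)
            (switch₄ (+ 0 , + 0) (+ 1 , -[1+ 0 ]) (+ 1 , + 0) (+ 0 , + 1) (done 1)))
          impossible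
          impossible
          impossible)
        (ask (+ 0 , + 1) impossible impossible impossible impossible impossible impossible))
      (switch₄ (+ 0 , + 0) (+ 1 , -[1+ 0 ]) (+ 1 , + 0) (+ 0 , + 1) (done 1)))
    impossible)

certificate-valid : Valid 3 0 [] certificate
certificate-valid = toWitness {a? = valid? 3 0 [] certificate} tt

walks-to-reference : ∀ m n h (n≡ : n ≡ double h) (M : Dimer m n) → Walk 3 (m * n) M (Reference.M₀ n≡)
walks-to-reference m n h n≡ = Sweep.walks-to-M₀ 3 progress
  where
  open Reference {m} n≡
  progress : Sweep.LocalProgress 3
  progress M i t i<m 2t+1<n = Semantics.progress n≡ 3 i<m 2t+1<n certificate certificate-valid M

*2≡double : ∀ h → h * 2 ≡ double h
*2≡double zero    = refl
*2≡double (suc h) = cong (suc ∘ suc) (*2≡double h)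

theorem1p8 : ∀ (m n : ℕ) → 1 ≤ m → 1 ≤ n → 2 ∣ m * n →
    ConnectedDiamAtMost 3 m n (2 * (m * n))
theorem1p8 m n _ _ 2∣mn with euclidsLemma m n (from-yes (prime? 2)) 2∣mn
... | inj₂ (divides h n≡) = diameter-via-hub (m * n) _ (walks-to-reference m n h (trans n≡ (*2≡double h)))
... | inj₁ (divides h m≡) = subst (ConnectedDiamAtMost 3 m n ∘ (2 *_)) (*-comm n m)
  (diameter-via-hub (n * m) _ (walks-to-transpose (walks-to-reference n m h (trans m≡ (*2≡double h)))))
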